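{- Let $I$ be an abelian ideal of $\Phi^+$, $\Psi$ a root subsystem of $\Phi$, and $\Psi_1,\dots,\Psi_k$ the irreducible components of $\Psi$. If $I\cap\Psi$ is $\sim$closed, then for all $\beta_1,\beta_2\in I\cap\Psi$ we have $\beta_1\lesssim\beta_2$ if and only if there exists $i\in\{1,\dots,k\}$ such that $\beta_1,\beta_2\in\Psi_i$ and $\beta_1\lesssim_{I\cap\Psi_i}\beta_2$.
   Context: $\Phi$ is an irreducible crystallographic root system, $\Phi^+$ a positive system with simple system $\Pi$. The standard partial order: $x\le y$ iff $y-x$ is a nonnegative integer combination of $\Pi$; $x<y$ means $x\le y$, $x\ne y$. An abelian ideal of $\Phi^+$ is a subset $I\subseteq\Phi^+$ such that $\beta\in I$, $\gamma\in\Phi^+$, $\beta\le\gamma$ imply $\gamma\in I$, and $\beta+\gamma\notin\Phi$ for all $\beta,\gamma\in I$. For $\beta_1,\beta_2\in\Phi^+$, a middle pair between them is $\{\gamma_1,\gamma_2\}\subseteq\Phi^+$ (possibly $\gamma_1=\gamma_2$) with $\beta_1+\beta_2=\gamma_1+\gamma_2$ and $\beta_1<\gamma_i<\beta_2$ ($i=1,2$); $\beta_1\lesssim\beta_2$ means such a middle pair exists. For $S\subseteq\Phi^+$ and $\beta_1,\beta_2\in S$, $\beta_1\lesssim_S\beta_2$ means there exists a middle pair between $\beta_1$ and $\beta_2$ contained in $S$. $S$ is called $\sim$closed if for all $\beta_1,\beta_2\in S$, $\beta_1\lesssim\beta_2$ implies $\beta_1\lesssim_S\beta_2$.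
   Formalization: The root system Φ is taken in ℚ^n with the standard dot product, so the ideal I, the subsystem Ψ and its components Ψ_1,…,Ψ_k consist of rational vectors. -}

module Defs where

open import Data.Nat using (ℕ; zero; suc)
open import Data.Integer using (ℤ; +_)
open import Data.Rational using (ℚ; 0ℚ; 1ℚ; _+_; _*_; _-_; -_; _/_)
open import Data.Fin using (Fin; zero; suc)
open import Data.List using (List; [])
open import Data.List.Relation.Unary.Any using (Any)
open import Data.Product using (Σ; ∃; _×_; _,_)
open import Data.Sum using (_⊎_)
open import Relation.Binary.PropositionalEquality using (_≡_; _≢_)
open import Relation.Nullary using (¬_)
open import Relation.Unary using (Pred)
open import Level using (0ℓ)

-- The ambient Euclidean space: ℚ^n with the standard dot product.
-- (Every crystallographic root system has a rational form.)

V : ℕ → Set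
V n = Fin n → ℚ

Subset : ℕ → Set₁
Subset n = Pred (V n) 0ℓ

sumFin : ∀ {r} → (Fin r → ℚ) → ℚ
sumFin {zero}  f = 0ℚ
sumFin {suc r} f = f zero + sumFin (λ i → f (suc i))

_⊕_ : ∀ {n} → V n → V n → V n
(u ⊕ v) j = u j + v j

_⊖_ : ∀ {n} → V n → V n → V n
(u ⊖ v) j = u j - v j

_·ᵥ_ : ∀ {n} → ℚ → V n → V n
(c ·ᵥ v) j = c * v j

0ᵥ : ∀ {n} → V n
0ᵥ j = 0ℚ

⟪_,_⟫ : ∀ {n} → V n → V n → ℚ
⟪ u , v ⟫ = sumFin (λ j → u j * v j)

_≈ᵥ_ : ∀ {n} → V n → V n → Set
u ≈ᵥ v = ∀ j → u j ≡ v j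

ℤtoℚ : ℤ → ℚ
ℤtoℚ m = m / 1

ℕtoℚ : ℕ → ℚ
ℕtoℚ m = (+ m) / 1

lincomb : ∀ {n r} → (Fin r → ℚ) → (Fin r → V n) → V n
lincomb c π j = sumFin (λ i → c i * π i j)

_∈Φ_ : ∀ {n} → V n → List (V n) → Set
v ∈Φ Φ = Any (λ w → w ≈ᵥ v) Φ

record IsRootSystem {n : ℕ} (Φ : List (V n)) : Set where
  field
    nonzero    : ∀ α → α ∈Φ Φ → ¬ (α ≈ᵥ 0ᵥ)
    crystallo  : ∀ α β → α ∈Φ Φ → β ∈Φ Φ →
                 ∃ λ (m : ℤ) → ℤtoℚ (+ 2) * ⟪ α , β ⟫ ≡ ℤtoℚ m * ⟪ α , α ⟫
    reflClosed : ∀ α β → α ∈Φ Φ → β ∈Φ Φ → (m : ℤ) →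
                 ℤtoℚ (+ 2) * ⟪ α , β ⟫ ≡ ℤtoℚ m * ⟪ α , α ⟫ →
                 (β ⊖ (ℤtoℚ m ·ᵥ α)) ∈Φ Φ
    reduced    : ∀ α (c : ℚ) → α ∈Φ Φ → (c ·ᵥ α) ∈Φ Φ → (c ≡ 1ℚ) ⊎ (c ≡ - 1ℚ)

IrreducibleSet : ∀ {n} → Subset n → Set₁
IrreducibleSet {n} S =
  (∃ λ α → S α) ×
  ((A B : Subset n) → (∀ x → S x → A x ⊎ B x) →
   (∀ x y → S x → S y → A x → B y → ⟪ x , y ⟫ ≡ 0ℚ) →
   (∀ x → S x → A x) ⊎ (∀ x → S x → B x))

record IsIrreducibleRootSystem {n : ℕ} (Φ : List (V n)) : Set₁ where
  field
    rootSystem  : IsRootSystem Φ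
    irreducible : IrreducibleSet (λ v → v ∈Φ Φ)

NonnegIntComb : ∀ {n r} → (Fin r → V n) → V n → Set
NonnegIntComb {r = r} Π v = Σ (Fin r → ℕ) λ c → v ≈ᵥ lincomb (λ i → ℕtoℚ (c i)) Π

NonposIntComb : ∀ {n r} → (Fin r → V n) → V n → Set
NonposIntComb {r = r} Π v = Σ (Fin r → ℕ) λ c → v ≈ᵥ lincomb (λ i → - ℕtoℚ (c i)) Π

record IsSimpleSystem {n r : ℕ} (Φ : List (V n)) (Π : Fin r → V n) : Set where
  field
    inΦ          : ∀ i → Π i ∈Φ Φ
    linIndep     : (c : Fin r → ℚ) → lincomb c Π ≈ᵥ 0ᵥ → ∀ i → c i ≡ 0ℚ
    signCoherent : ∀ α → α ∈Φ Φ → NonnegIntComb Π α ⊎ NonposIntComb Π α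

module RootOrder {n r : ℕ} (Φ : List (V n)) (Π : Fin r → V n) where

  Pos : Subset n
  Pos α = α ∈Φ Φ × NonnegIntComb Π α

  _≼_ : V n → V n → Set
  x ≼ y = NonnegIntComb Π (y ⊖ x)

  _≺_ : V n → V n → Set
  x ≺ y = x ≼ y × ¬ (x ≈ᵥ y)

  record AbelianIdeal (I : Subset n) : Set where
    field
      ⊆Pos    : ∀ β → I β → Pos β
      upClosed : ∀ β γ → I β → Pos γ → β ≼ γ → I γ
      abelian  : ∀ β γ → I β → I γ → ¬ ((β ⊕ γ) ∈Φ Φ)

  MiddlePair : V n → V n → V n → V n → Set
  MiddlePair β₁ β₂ γ₁ γ₂ =
    Pos γ₁ × Pos γ₂ × ((β₁ ⊕ β₂) ≈ᵥ (γ₁ ⊕ γ₂)) ×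
    (β₁ ≺ γ₁) × (γ₁ ≺ β₂) × (β₁ ≺ γ₂) × (γ₂ ≺ β₂)

  _≲_ : V n → V n → Set
  β₁ ≲ β₂ = ∃ λ γ₁ → ∃ λ γ₂ → MiddlePair β₁ β₂ γ₁ γ₂

  ≲[_] : Subset n → V n → V n → Set
  ≲[ S ] β₁ β₂ = ∃ λ γ₁ → ∃ λ γ₂ → MiddlePair β₁ β₂ γ₁ γ₂ × S γ₁ × S γ₂

  SimClosed : Subset n → Set
  SimClosed S = ∀ β₁ β₂ → S β₁ → S β₂ → β₁ ≲ β₂ → ≲[ S ] β₁ β₂

record IsRootSubsystem {n : ℕ} (Φ : List (V n)) (Ψ : Subset n) : Set where
  field
    ⊆Φ        : ∀ α → Ψ α → α ∈Φ Φ
    reflClosed : ∀ α β → Ψ α → Ψ β → (m : ℤ) →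
                 ℤtoℚ (+ 2) * ⟪ α , β ⟫ ≡ ℤtoℚ m * ⟪ α , α ⟫ →
                 Ψ (β ⊖ (ℤtoℚ m ·ᵥ α))

record AreIrreducibleComponents {n k : ℕ} (Ψ : Subset n) (Ψc : Fin k → Subset n) : Set₁ where
  field
    ⊆Ψ          : ∀ i x → Ψc i x → Ψ x
    covers      : ∀ x → Ψ x → ∃ λ i → Ψc i x
    orthogonal  : ∀ i j x y → i ≢ j → Ψc i x → Ψc j y → ⟪ x , y ⟫ ≡ 0ℚ
    irreducible : ∀ i → IrreducibleSet (Ψc i)

_∩_ : ∀ {n} → Subset n → Subset n → Subset n
(A ∩ B) x = A x × B x

-- By ∼closedness β₁ and β₂ have a middle pair γ₁, γ₂ inside I ∩ Ψ; it remains to see that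
-- all four roots lie in a single component Ψᵢ.  The components are mutually orthogonal and
-- consist of anisotropic vectors, and β₁ + β₂ ≠ 0 because both roots are positive.  If the
-- component of β₁ contained neither γ₁ nor γ₂, then β₁ would be orthogonal to
-- γ₁ + γ₂ = β₁ + β₂, which is impossible.  If β₁ and β₂ lay in different components, the
-- same argument puts γ₁ and γ₂ one in each of them; but the decomposition of a vector into
-- orthogonal components is unique, so β₁ ∈ {γ₁, γ₂}, contradicting β₁ < γ₁, γ₂.  Once β₁
-- and β₂ share a component, so does each γⱼ.
module Submission where

open import Defs
open import Data.Nat using (ℕ; zero; suc)
open import Data.Fin using (Fin; zero; suc)
open import Data.Fin.Properties using () renaming (_≟_ to _≟ᶠ_)
open import Data.List using (List)
open import Data.Product using (∃; _×_; _,_; proj₂)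
open import Data.Sum using (_⊎_; inj₁; inj₂)
open import Data.Empty using (⊥; ⊥-elim)
open import Function.Bundles using (_⇔_; mk⇔)
open import Relation.Nullary using (¬_; Dec; yes; no)
open import Relation.Binary.PropositionalEquality
open import Data.Rational using (ℚ; 0ℚ; 1ℚ; _+_; _*_; _-_; -_; _≤_; 1/_; nonNegative; nonPositive; ≢-nonZero)
open import Data.Rational.Properties
open import Data.Rational.Solver using (module +-*-Solver)
open import Algebra.Bundles using (CommutativeMonoid)
open import Algebra.Properties.CommutativeSemigroup
  (CommutativeMonoid.commutativeSemigroup +-0-commutativeMonoid) using (interchange)
open import Algebra.Properties.Group +-0-group using (x∙y⁻¹≈ε⇒x≈y)

open ≡-Reasoning

nonneg+nonneg≡0⇒≡0 : ∀ {a b} → 0ℚ ≤ a → 0ℚ ≤ b → a + b ≡ 0ℚ → a ≡ 0ℚ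
nonneg+nonneg≡0⇒≡0 {a} {b} 0≤a 0≤b a+b≡0 = ≤-antisym a≤0 0≤a
  where
  a≤0 : a ≤ 0ℚ
  a≤0 = ≤-trans (≤-reflexive (sym (+-identityʳ a)))
          (≤-trans (+-monoʳ-≤ a 0≤b) (≤-reflexive a+b≡0))

x*x-nonneg : ∀ x → 0ℚ ≤ x * x
x*x-nonneg x with ≤-total 0ℚ x
... | inj₁ 0≤x = let instance _ = nonNegative 0≤x in
                 nonNegative⁻¹ (x * x) {{nonNeg*nonNeg⇒nonNeg x x}}
... | inj₂ x≤0 = let instance _ = nonPositive x≤0 in
                 nonNegative⁻¹ (x * x) {{nonPos*nonPos⇒nonPos x x}}

x*x≡0⇒x≡0 : ∀ {x} → x * x ≡ 0ℚ → x ≡ 0ℚ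
x*x≡0⇒x≡0 {x} x*x≡0 with x ≟ 0ℚ
... | yes x≡0 = x≡0
... | no x≢0 = let instance _ = ≢-nonZero x≢0 in begin
  x                ≡⟨ sym (*-identityˡ x) ⟩
  1ℚ * x           ≡⟨ cong (_* x) (sym (*-inverseˡ x)) ⟩
  (1/ x * x) * x   ≡⟨ *-assoc (1/ x) x x ⟩
  1/ x * (x * x)   ≡⟨ cong (1/ x *_) x*x≡0 ⟩
  1/ x * 0ℚ        ≡⟨ *-zeroʳ (1/ x) ⟩
  0ℚ               ∎

ℕtoℚ-nonneg : ∀ m → 0ℚ ≤ ℕtoℚ m
ℕtoℚ-nonneg m = nonNegative⁻¹ (ℕtoℚ m) {{normalize-nonNeg m 1}}

sumFin-cong : ∀ {r} {f g : Fin r → ℚ} → (∀ i → f i ≡ g i) → sumFin f ≡ sumFin g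
sumFin-cong {zero}  f≗g = refl
sumFin-cong {suc r} f≗g = cong₂ _+_ (f≗g zero) (sumFin-cong (λ i → f≗g (suc i)))

sumFin-+ : ∀ {r} (f g : Fin r → ℚ) → sumFin (λ i → f i + g i) ≡ sumFin f + sumFin g
sumFin-+ {zero}  f g = refl
sumFin-+ {suc r} f g = begin
  (f zero + g zero) + sumFin (λ i → f (suc i) + g (suc i))
    ≡⟨ cong ((f zero + g zero) +_) (sumFin-+ (λ i → f (suc i)) (λ i → g (suc i))) ⟩
  (f zero + g zero) + (sumFin (λ i → f (suc i)) + sumFin (λ i → g (suc i)))
    ≡⟨ interchange (f zero) (g zero) _ _ ⟩
  (f zero + sumFin (λ i → f (suc i))) + (g zero + sumFin (λ i → g (suc i))) ∎

sumFin-neg : ∀ {r} (f : Fin r → ℚ) → sumFin (λ i → - f i) ≡ - sumFin f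
sumFin-neg {zero}  f = refl
sumFin-neg {suc r} f = begin
  - f zero + sumFin (λ i → - f (suc i)) ≡⟨ cong (- f zero +_) (sumFin-neg (λ i → f (suc i))) ⟩
  - f zero + - sumFin (λ i → f (suc i)) ≡⟨ sym (neg-distrib-+ (f zero) _) ⟩
  - (f zero + sumFin (λ i → f (suc i))) ∎

sumFin-zero : ∀ {r} {f : Fin r → ℚ} → (∀ i → f i ≡ 0ℚ) → sumFin f ≡ 0ℚ
sumFin-zero {zero}  f≗0 = refl
sumFin-zero {suc r} f≗0 = cong₂ _+_ (f≗0 zero) (sumFin-zero (λ i → f≗0 (suc i)))

sumFin-nonneg : ∀ {r} {f : Fin r → ℚ} → (∀ i → 0ℚ ≤ f i) → 0ℚ ≤ sumFin f
sumFin-nonneg {zero}  0≤f = ≤-refl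
sumFin-nonneg {suc r} 0≤f =
  ≤-trans (≤-reflexive (sym (+-identityʳ 0ℚ)))
    (+-mono-≤ (0≤f zero) (sumFin-nonneg (λ i → 0≤f (suc i))))

sumFin-nonneg-≡0 : ∀ {r} {f : Fin r → ℚ} → (∀ i → 0ℚ ≤ f i) → sumFin f ≡ 0ℚ → ∀ i → f i ≡ 0ℚ
sumFin-nonneg-≡0 {suc r} 0≤f Σf≡0 zero =
  nonneg+nonneg≡0⇒≡0 (0≤f zero) (sumFin-nonneg (λ i → 0≤f (suc i))) Σf≡0
sumFin-nonneg-≡0 {suc r} {f} 0≤f Σf≡0 (suc i) =
  sumFin-nonneg-≡0 (λ i → 0≤f (suc i)) Σtail≡0 i
  where
  Σtail≡0 : sumFin (λ i → f (suc i)) ≡ 0ℚ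
  Σtail≡0 = begin
    sumFin (λ i → f (suc i))        ≡⟨ sym (+-identityˡ _) ⟩
    0ℚ + sumFin (λ i → f (suc i))   ≡⟨ cong (_+ sumFin (λ i → f (suc i)))
                                          (sym (sumFin-nonneg-≡0 0≤f Σf≡0 zero)) ⟩
    f zero + sumFin (λ i → f (suc i)) ≡⟨ Σf≡0 ⟩
    0ℚ                              ∎

module _ {n : ℕ} where

  ⊕-comm : (x y : V n) → (x ⊕ y) ≈ᵥ (y ⊕ x)
  ⊕-comm x y j = +-comm (x j) (y j)

  lincomb-+ : ∀ {r} (c d : Fin r → ℚ) (π : Fin r → V n) →
              lincomb (λ i → c i + d i) π ≈ᵥ (lincomb c π ⊕ lincomb d π)
  lincomb-+ c d π j = trans (sumFin-cong (λ i → *-distribʳ-+ (π i j) (c i) (d i)))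
                            (sumFin-+ (λ i → c i * π i j) (λ i → d i * π i j))

  lincomb-zero : ∀ {r} {c : Fin r → ℚ} (π : Fin r → V n) → (∀ i → c i ≡ 0ℚ) → lincomb c π ≈ᵥ 0ᵥ
  lincomb-zero {c = c} π c≗0 j =
    sumFin-zero (λ i → trans (cong (_* π i j) (c≗0 i)) (*-zeroˡ (π i j)))

  ⟪⟫-sym : (x y : V n) → ⟪ x , y ⟫ ≡ ⟪ y , x ⟫
  ⟪⟫-sym x y = sumFin-cong (λ j → *-comm (x j) (y j))

  ⟪⟫-congʳ : (z : V n) {x y : V n} → x ≈ᵥ y → ⟪ z , x ⟫ ≡ ⟪ z , y ⟫
  ⟪⟫-congʳ z x≈y = sumFin-cong (λ j → cong (z j *_) (x≈y j))

  ⟪⟫-⊕ˡ : (x y z : V n) → ⟪ x ⊕ y , z ⟫ ≡ ⟪ x , z ⟫ + ⟪ y , z ⟫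
  ⟪⟫-⊕ˡ x y z = trans (sumFin-cong (λ j → *-distribʳ-+ (z j) (x j) (y j)))
                      (sumFin-+ (λ j → x j * z j) (λ j → y j * z j))

  ⟪⟫-⊖ˡ : (x y z : V n) → ⟪ x ⊖ y , z ⟫ ≡ ⟪ x , z ⟫ - ⟪ y , z ⟫
  ⟪⟫-⊖ˡ x y z = begin
    sumFin (λ j → (x j - y j) * z j)
      ≡⟨ sumFin-cong (λ j → trans (*-distribʳ-+ (z j) (x j) (- y j))
                                  (cong (x j * z j +_) (sym (neg-distribˡ-* (y j) (z j))))) ⟩
    sumFin (λ j → x j * z j + - (y j * z j))
      ≡⟨ sumFin-+ (λ j → x j * z j) (λ j → - (y j * z j)) ⟩
    ⟪ x , z ⟫ + sumFin (λ j → - (y j * z j))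
      ≡⟨ cong (⟪ x , z ⟫ +_) (sumFin-neg (λ j → y j * z j)) ⟩
    ⟪ x , z ⟫ - ⟪ y , z ⟫ ∎

  ⟪⟫-⊕ʳ : (x y z : V n) → ⟪ z , x ⊕ y ⟫ ≡ ⟪ z , x ⟫ + ⟪ z , y ⟫
  ⟪⟫-⊕ʳ x y z = begin
    ⟪ z , x ⊕ y ⟫         ≡⟨ ⟪⟫-sym z (x ⊕ y) ⟩
    ⟪ x ⊕ y , z ⟫         ≡⟨ ⟪⟫-⊕ˡ x y z ⟩
    ⟪ x , z ⟫ + ⟪ y , z ⟫ ≡⟨ cong₂ _+_ (⟪⟫-sym x z) (⟪⟫-sym y z) ⟩
    ⟪ z , x ⟫ + ⟪ z , y ⟫ ∎

  ⟪⟫-⊖ʳ : (x y z : V n) → ⟪ z , x ⊖ y ⟫ ≡ ⟪ z , x ⟫ - ⟪ z , y ⟫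
  ⟪⟫-⊖ʳ x y z = begin
    ⟪ z , x ⊖ y ⟫         ≡⟨ ⟪⟫-sym z (x ⊖ y) ⟩
    ⟪ x ⊖ y , z ⟫         ≡⟨ ⟪⟫-⊖ˡ x y z ⟩
    ⟪ x , z ⟫ - ⟪ y , z ⟫ ≡⟨ cong₂ _-_ (⟪⟫-sym x z) (⟪⟫-sym y z) ⟩
    ⟪ z , x ⟫ - ⟪ z , y ⟫ ∎

  ⟪x,x⟫≡0⇒x≈0 : (x : V n) → ⟪ x , x ⟫ ≡ 0ℚ → x ≈ᵥ 0ᵥ
  ⟪x,x⟫≡0⇒x≈0 x ⟪x,x⟫≡0 j =
    x*x≡0⇒x≡0 (sumFin-nonneg-≡0 (λ j → x*x-nonneg (x j)) ⟪x,x⟫≡0 j)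

nonnegIntComb-⊕-≉0 : ∀ {n r} {Φ : List (V n)} {Π : Fin r → V n} → IsSimpleSystem Φ Π →
  {β₁ β₂ : V n} → ¬ (β₁ ≈ᵥ 0ᵥ) → NonnegIntComb Π β₁ → NonnegIntComb Π β₂ →
  ¬ ((β₁ ⊕ β₂) ≈ᵥ 0ᵥ)
nonnegIntComb-⊕-≉0 {Π = Π} simple {β₁} {β₂} β₁≉0 (c , β₁≈Σc) (d , β₂≈Σd) β₁⊕β₂≈0 =
  β₁≉0 (λ j → trans (β₁≈Σc j) (lincomb-zero Π c≡0 j))
  where
  C D : Fin _ → ℚ
  C i = ℕtoℚ (c i)
  D i = ℕtoℚ (d i)
  Σ[c+d]≈0 : lincomb (λ i → C i + D i) Π ≈ᵥ 0ᵥ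
  Σ[c+d]≈0 j = begin
    lincomb (λ i → C i + D i) Π j       ≡⟨ lincomb-+ C D Π j ⟩
    lincomb C Π j + lincomb D Π j       ≡⟨ cong₂ _+_ (sym (β₁≈Σc j)) (sym (β₂≈Σd j)) ⟩
    β₁ j + β₂ j                         ≡⟨ β₁⊕β₂≈0 j ⟩
    0ℚ                                  ∎
  c≡0 : ∀ i → C i ≡ 0ℚ
  c≡0 i = nonneg+nonneg≡0⇒≡0 (ℕtoℚ-nonneg (c i)) (ℕtoℚ-nonneg (d i))
            (IsSimpleSystem.linIndep simple (λ i → C i + D i) Σ[c+d]≈0 i)

module OrthogonalFamily {n k : ℕ} (Ψc : Fin k → Subset n)
  (orthogonal : ∀ i j x y → i ≢ j → Ψc i x → Ψc j y → ⟪ x , y ⟫ ≡ 0ℚ)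
  (anisotropic : ∀ i x → Ψc i x → ⟪ x , x ⟫ ≢ 0ℚ) where

  orthogonal-to-⊕ : ∀ {z u v p c d} → p ≢ c → p ≢ d → Ψc p z → Ψc c u → Ψc d v → ⟪ z , u ⊕ v ⟫ ≡ 0ℚ
  orthogonal-to-⊕ {z} {u} {v} {p} {c} {d} p≢c p≢d z∈p u∈c v∈d = begin
    ⟪ z , u ⊕ v ⟫         ≡⟨ ⟪⟫-⊕ʳ u v z ⟩
    ⟪ z , u ⟫ + ⟪ z , v ⟫ ≡⟨ cong₂ _+_ (orthogonal p c z u p≢c z∈p u∈c)
                                       (orthogonal p d z v p≢d z∈p v∈d) ⟩
    0ℚ                    ∎

  summand-component : ∀ {x y u v p q c d} → Ψc p x → Ψc q y → Ψc c u → Ψc d v →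
    (x ⊕ y) ≈ᵥ (u ⊕ v) → ¬ ((x ⊕ y) ≈ᵥ 0ᵥ) → p ≡ c ⊎ p ≡ d
  summand-component {x} {y} {u} {v} {p} {q} {c} {d} x∈p y∈q u∈c v∈d x⊕y≈u⊕v x⊕y≉0
    with p ≟ᶠ c | p ≟ᶠ d
  ... | yes p≡c | _       = inj₁ p≡c
  ... | no _    | yes p≡d = inj₂ p≡d
  ... | no p≢c  | no p≢d  = ⊥-elim (impossible (p ≟ᶠ q))
    where
    ⊥x⊕y : ∀ {z} → Ψc p z → ⟪ z , x ⊕ y ⟫ ≡ 0ℚ
    ⊥x⊕y {z} z∈p = trans (⟪⟫-congʳ z x⊕y≈u⊕v) (orthogonal-to-⊕ p≢c p≢d z∈p u∈c v∈d)
    impossible : Dec (p ≡ q) → ⊥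
    impossible (no p≢q) = anisotropic p x x∈p (begin
      ⟪ x , x ⟫               ≡⟨ sym (+-identityʳ _) ⟩
      ⟪ x , x ⟫ + 0ℚ          ≡⟨ cong (⟪ x , x ⟫ +_) (sym (orthogonal p q x y p≢q x∈p y∈q)) ⟩
      ⟪ x , x ⟫ + ⟪ x , y ⟫   ≡⟨ sym (⟪⟫-⊕ʳ x y x) ⟩
      ⟪ x , x ⊕ y ⟫           ≡⟨ ⊥x⊕y x∈p ⟩
      0ℚ                      ∎)
    impossible (yes refl) = x⊕y≉0 (⟪x,x⟫≡0⇒x≈0 (x ⊕ y) (begin
      ⟪ x ⊕ y , x ⊕ y ⟫             ≡⟨ ⟪⟫-⊕ˡ x y (x ⊕ y) ⟩
      ⟪ x , x ⊕ y ⟫ + ⟪ y , x ⊕ y ⟫ ≡⟨ cong₂ _+_ (⊥x⊕y x∈p) (⊥x⊕y y∈q) ⟩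
      0ℚ                            ∎))

  summand-unique : ∀ {x y u v p q} → p ≢ q → Ψc p x → Ψc q y → Ψc p u → Ψc q v →
    (x ⊕ y) ≈ᵥ (u ⊕ v) → x ≈ᵥ u
  summand-unique {x} {y} {u} {v} {p} {q} p≢q x∈p y∈q u∈p v∈q x⊕y≈u⊕v j =
    x∙y⁻¹≈ε⇒x≈y (x j) (u j) (⟪x,x⟫≡0⇒x≈0 (x ⊖ u) ⟪x⊖u,x⊖u⟫≡0 j)
    where
    open +-*-Solver using (solve; _:+_; _:-_; _:=_)
    x⊖u≈v⊖y : (x ⊖ u) ≈ᵥ (v ⊖ y)
    x⊖u≈v⊖y i = begin
      x i - u i               ≡⟨ solve 3 (λ a b c → a :- b := (a :+ c) :- b :- c) refl (x i) (u i) (y i) ⟩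
      (x i + y i) - u i - y i ≡⟨ cong (λ t → t - u i - y i) (x⊕y≈u⊕v i) ⟩
      (u i + v i) - u i - y i ≡⟨ solve 3 (λ a b c → (a :+ b) :- a :- c := b :- c) refl (u i) (v i) (y i) ⟩
      v i - y i               ∎
    ⟪x⊖u,x⊖u⟫≡0 : ⟪ x ⊖ u , x ⊖ u ⟫ ≡ 0ℚ
    ⟪x⊖u,x⊖u⟫≡0 = begin
      ⟪ x ⊖ u , x ⊖ u ⟫ ≡⟨ ⟪⟫-congʳ (x ⊖ u) x⊖u≈v⊖y ⟩
      ⟪ x ⊖ u , v ⊖ y ⟫ ≡⟨ ⟪⟫-⊖ʳ v y (x ⊖ u) ⟩
      ⟪ x ⊖ u , v ⟫ - ⟪ x ⊖ u , y ⟫ ≡⟨ cong₂ _-_ (⟪⟫-⊖ˡ x u v) (⟪⟫-⊖ˡ x u y) ⟩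
      (⟪ x , v ⟫ - ⟪ u , v ⟫) - (⟪ x , y ⟫ - ⟪ u , y ⟫)
        ≡⟨ cong₂ _-_ (cong₂ _-_ (orthogonal p q x v p≢q x∈p v∈q) (orthogonal p q u v p≢q u∈p v∈q))
                     (cong₂ _-_ (orthogonal p q x y p≢q x∈p y∈q) (orthogonal p q u y p≢q u∈p y∈q)) ⟩
      (0ℚ - 0ℚ) - (0ℚ - 0ℚ) ≡⟨⟩
      0ℚ ∎

  summands-share-component : ∀ {x y u v a b c d} → Ψc a x → Ψc b y → Ψc c u → Ψc d v →
    (x ⊕ y) ≈ᵥ (u ⊕ v) → ¬ ((x ⊕ y) ≈ᵥ 0ᵥ) → ¬ (x ≈ᵥ u) → ¬ (x ≈ᵥ v) → a ≡ b
  summands-share-component {x} {y} {u} {v} {a} {b} {c} {d} x∈a y∈b u∈c v∈d x⊕y≈u⊕v x⊕y≉0 x≉u x≉v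
    with a ≟ᶠ b
  ... | yes a≡b = a≡b
  ... | no a≢b  = ⊥-elim (placements
        (summand-component x∈a y∈b u∈c v∈d x⊕y≈u⊕v x⊕y≉0)
        (summand-component y∈b x∈a u∈c v∈d y⊕x≈u⊕v (λ y⊕x≈0 → x⊕y≉0 (λ j → trans (⊕-comm x y j) (y⊕x≈0 j)))))
    where
    y⊕x≈u⊕v : (y ⊕ x) ≈ᵥ (u ⊕ v)
    y⊕x≈u⊕v j = trans (⊕-comm y x j) (x⊕y≈u⊕v j)
    x⊕y≈v⊕u : (x ⊕ y) ≈ᵥ (v ⊕ u)
    x⊕y≈v⊕u j = trans (x⊕y≈u⊕v j) (⊕-comm u v j)
    placements : a ≡ c ⊎ a ≡ d → b ≡ c ⊎ b ≡ d → ⊥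
    placements (inj₁ a≡c) (inj₁ b≡c) = a≢b (trans a≡c (sym b≡c))
    placements (inj₂ a≡d) (inj₂ b≡d) = a≢b (trans a≡d (sym b≡d))
    placements (inj₁ refl) (inj₂ refl) = x≉u (summand-unique a≢b x∈a y∈b u∈c v∈d x⊕y≈u⊕v)
    placements (inj₂ refl) (inj₁ refl) = x≉v (summand-unique a≢b x∈a y∈b v∈d u∈c x⊕y≈v⊕u)

  summand-in-component : ∀ {x y u v a c d} → Ψc a x → Ψc a y → Ψc c u → Ψc d v →
    (u ⊕ v) ≈ᵥ (x ⊕ y) → ¬ ((x ⊕ y) ≈ᵥ 0ᵥ) → Ψc a u
  summand-in-component x∈a y∈a u∈c v∈d u⊕v≈x⊕y x⊕y≉0
    with summand-component u∈c v∈d x∈a y∈a u⊕v≈x⊕y (λ u⊕v≈0 → x⊕y≉0 (λ j → trans (sym (u⊕v≈x⊕y j)) (u⊕v≈0 j)))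
  ... | inj₁ refl = u∈c
  ... | inj₂ refl = u∈c

  summands-in-one-component : ∀ {x y u v a b c d} → Ψc a x → Ψc b y → Ψc c u → Ψc d v →
    (x ⊕ y) ≈ᵥ (u ⊕ v) → ¬ ((x ⊕ y) ≈ᵥ 0ᵥ) → ¬ (x ≈ᵥ u) → ¬ (x ≈ᵥ v) →
    Ψc a y × Ψc a u × Ψc a v
  summands-in-one-component {x} {y} {u} {v} x∈a y∈b u∈c v∈d x⊕y≈u⊕v x⊕y≉0 x≉u x≉v
    with summands-share-component x∈a y∈b u∈c v∈d x⊕y≈u⊕v x⊕y≉0 x≉u x≉v
  ... | refl = y∈b
             , summand-in-component x∈a y∈b u∈c v∈d (λ j → sym (x⊕y≈u⊕v j)) x⊕y≉0
             , summand-in-component x∈a y∈b v∈d u∈c (λ j → trans (⊕-comm v u j) (sym (x⊕y≈u⊕v j))) x⊕y≉0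

lemma5p4 : (n : ℕ) (Φ : List (V n)) → IsIrreducibleRootSystem Φ →
    (r : ℕ) (Π : Fin r → V n) → IsSimpleSystem Φ Π →
    (I : Subset n) → RootOrder.AbelianIdeal Φ Π I →
    (Ψ : Subset n) → IsRootSubsystem Φ Ψ →
    (k : ℕ) (Ψc : Fin k → Subset n) → AreIrreducibleComponents Ψ Ψc →
    RootOrder.SimClosed Φ Π (I ∩ Ψ) →
    (β₁ β₂ : V n) → (I ∩ Ψ) β₁ → (I ∩ Ψ) β₂ →
    (RootOrder._≲_ Φ Π β₁ β₂ ⇔
    (∃ λ (i : Fin k) → Ψc i β₁ × Ψc i β₂ × RootOrder.≲[_] Φ Π (I ∩ Ψc i) β₁ β₂))
lemma5p4 n Φ Φ-irreducible r Π simple I ideal Ψ subsystem k Ψc components closed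
         β₁ β₂ β₁∈I∩Ψ@(β₁∈I , β₁∈Ψ) β₂∈I∩Ψ@(β₂∈I , β₂∈Ψ) = mk⇔ to from
  where
  open RootOrder Φ Π
  open AreIrreducibleComponents components using (⊆Ψ; covers; orthogonal)
  open IsRootSystem (IsIrreducibleRootSystem.rootSystem Φ-irreducible) using (nonzero)
  open OrthogonalFamily Ψc orthogonal (λ i x x∈Ψᵢ ⟪x,x⟫≡0 →
    nonzero x (IsRootSubsystem.⊆Φ subsystem x (⊆Ψ i x x∈Ψᵢ)) (⟪x,x⟫≡0⇒x≈0 x ⟪x,x⟫≡0))

  β₁⊕β₂≉0 : ¬ ((β₁ ⊕ β₂) ≈ᵥ 0ᵥ)
  β₁⊕β₂≉0 =
    let β₁∈Φ , β₁≥0 = AbelianIdeal.⊆Pos ideal β₁ β₁∈I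
        _    , β₂≥0 = AbelianIdeal.⊆Pos ideal β₂ β₂∈I
    in nonnegIntComb-⊕-≉0 simple (nonzero β₁ β₁∈Φ) β₁≥0 β₂≥0

  to : β₁ ≲ β₂ → ∃ λ i → Ψc i β₁ × Ψc i β₂ × ≲[ I ∩ Ψc i ] β₁ β₂
  to β₁≲β₂ = in-one-component (closed β₁ β₂ β₁∈I∩Ψ β₂∈I∩Ψ β₁≲β₂)
    where
    in-one-component : ≲[ I ∩ Ψ ] β₁ β₂ → ∃ λ i → Ψc i β₁ × Ψc i β₂ × ≲[ I ∩ Ψc i ] β₁ β₂
    in-one-component (γ₁ , γ₂ , middle@(_ , _ , β₁⊕β₂≈γ₁⊕γ₂ , (_ , β₁≉γ₁) , _ , (_ , β₁≉γ₂) , _) ,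
                      (γ₁∈I , γ₁∈Ψ) , (γ₂∈I , γ₂∈Ψ)) =
      let a , β₁∈a = covers β₁ β₁∈Ψ
          β₂∈a , γ₁∈a , γ₂∈a =
            summands-in-one-component β₁∈a (covers β₂ β₂∈Ψ .proj₂)
              (covers γ₁ γ₁∈Ψ .proj₂) (covers γ₂ γ₂∈Ψ .proj₂)
              β₁⊕β₂≈γ₁⊕γ₂ β₁⊕β₂≉0 β₁≉γ₁ β₁≉γ₂
      in a , β₁∈a , β₂∈a , γ₁ , γ₂ , middle , (γ₁∈I , γ₁∈a) , (γ₂∈I , γ₂∈a)

  from : (∃ λ i → Ψc i β₁ × Ψc i β₂ × ≲[ I ∩ Ψc i ] β₁ β₂) → β₁ ≲ β₂
  from (_ , _ , _ , γ₁ , γ₂ , middle , _) = γ₁ , γ₂ , middle
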